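{- For an integer $n$ (possibly negative) and a positive integer $\ell$, define the rational function $$X_{n,\ell}(u,t)=(t;t)_\ell\sum_{\lambda\vdash\ell}(ut)^{b(\lambda)}\prod_{x\in\lambda}\frac{1-u^{n+c(x)}}{(1-u^{h(x)})(1-t^{h(x)})}.$$ Then $t^{\binom{\ell}{2}}X_{n,\ell}(u,t^{ -1})=(-u^n)^\ell\,X_{ -n,\ell}(u,t)$.
   Context: The sum is over partitions $\lambda$ of $\ell$, and the products are over the cells $x$ of the Young diagram of $\lambda$. For a cell $x$ in row $i$ and column $j$, the content is $c(x)=j-i$ and the hook length $h(x)$ is the number of cells weakly to the right of $x$ in its row plus the number of cells strictly below $x$ in its column. $b(\lambda)=\sum_i(i-1)\lambda_i$, and $(z;t)_k=(1-z)(1-zt)\cdots(1-zt^{k-1})$. (For positive integers $n$, $X_{n,\ell}(u,t)$ equals $\sum_{w\in[n]^\ell}u^{\sum_i(w_i-1)}t^{\mathrm{maj}(w)}$, where $\mathrm{maj}(w)$ is the sum of positions $i<\ell$ with $w_i>w_{i+1}$.) -}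

module Defs where

open import Data.Nat as ℕ using (ℕ; zero; suc; _∸_; _⊓_)
open import Data.Integer as ℤ using (ℤ; +_; -[1+_])
open import Data.Rational as ℚ using (ℚ; 0ℚ; 1ℚ; _+_; _*_; _-_; 1/_)
open import Data.Rational.Properties using (_≟_)
open import Data.Nat.ListAction using (sum)
open import Data.List using (List; []; _∷_; map; concatMap; foldr; upTo; length; filter)
open import Data.Product using (_×_; _,_)
open import Relation.Nullary using (yes; no)
open import Relation.Nullary.Decidable using (⌊_⌋)
import Data.Nat.Properties as ℕP

-- Total multiplicative inverse on ℚ with the convention inv 0 = 0.
-- (The theorem's hypotheses guarantee that it is never applied to 0.)
inv : ℚ → ℚ
inv q with q ≟ 0ℚ
... | yes _ = 0ℚ
... | no ¬p = 1/_ q {{ℚ.≢-nonZero ¬p}}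

_÷'_ : ℚ → ℚ → ℚ
p ÷' q = p * inv q

_^_ : ℚ → ℕ → ℚ
q ^ zero = 1ℚ
q ^ suc k = q * (q ^ k)

_^ᶻ_ : ℚ → ℤ → ℚ
q ^ᶻ (+ k) = q ^ k
q ^ᶻ -[1+ k ] = inv (q ^ suc k)

prod : List ℚ → ℚ
prod = foldr _*_ 1ℚ

sumℚ : List ℚ → ℚ
sumℚ = foldr _+_ 0ℚ

poch : ℚ → ℚ → ℕ → ℚ
poch z t k = prod (map (λ i → 1ℚ - z * (t ^ i)) (upTo k))

-- Partitions are represented as weakly decreasing lists of positive parts
-- [λ₁, λ₂, …].  partsLe fuel m k lists all partitions of k with all parts
-- ≤ m (fuel ≥ k suffices).
partsLe : ℕ → ℕ → ℕ → List (List ℕ)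
partsLe _ _ zero = [] ∷ []
partsLe zero _ (suc _) = []
partsLe (suc f) m (suc k) =
  concatMap (λ i → let p = suc i in map (p ∷_) (partsLe f p (suc k ∸ p)))
            (upTo (m ⊓ suc k))

partitions : ℕ → List (List ℕ)
partitions ℓ = partsLe ℓ ℓ ℓ

-- j-th part (1-indexed rows), 0 beyond the length
part : List ℕ → ℕ → ℕ
part [] _ = 0
part (_ ∷ _) zero = 0
part (p ∷ _) (suc zero) = p
part (_ ∷ ps) (suc (suc i)) = part ps (suc i)

cells : List ℕ → List (ℕ × ℕ)
cells λ' = concatMap (λ i → map (λ j → (suc i , suc j)) (upTo (part λ' (suc i))))
                     (upTo (length λ'))

content : ℕ × ℕ → ℤ
content (i , j) = (+ j) ℤ.- (+ i)

-- hook length: (λ_i - j + 1) cells weakly right in the row,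
-- plus the number of rows i' > i with λ_{i'} ≥ j (cells strictly below).
hook : List ℕ → ℕ × ℕ → ℕ
hook λ' (i , j) =
  suc (part λ' i ∸ j)
  ℕ.+ length (filter (λ r → j ℕ.≤? part λ' r)
                     (map (λ k → i ℕ.+ suc k) (upTo (length λ' ∸ i))))
  where open import Data.Nat using (_≤?_)

bstat : List ℕ → ℕ
bstat λ' = sum (map (λ i → i ℕ.* part λ' (suc i)) (upTo (length λ')))

X : ℤ → ℕ → ℚ → ℚ → ℚ
X n ℓ u t = poch t t ℓ * sumℚ (map term (partitions ℓ))
  where
  term : List ℕ → ℚ
  term λ' = ((u * t) ^ bstat λ') *
    prod (map (λ x → (1ℚ - (u ^ᶻ (n ℤ.+ content x))) ÷'
                     ((1ℚ - (u ^ hook λ' x)) * (1ℚ - (t ^ hook λ' x))))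
              (cells λ'))

binom2 : ℕ → ℕ
binom2 zero = 0
binom2 (suc k) = k ℕ.+ binom2 k

-- The proof matches the summand of λ on the left with the summand of the
-- conjugate partition λ' on the right.  A cell x = (i,j) of λ (0-indexed
-- here) becomes the cell (j,i) of λ'; its hook length is unchanged, its
-- content changes sign, and the inversion t ↦ 1/t turns each factor
-- 1/(1 − t^{−h}) into −t^h/(1 − t^h), while 1 − u^{n+c} = −u^{n+c}(1 − u^{−n−c}).
-- The surplus t^{Σ h(x)} splits, using h = 1 + arm + leg, into
-- t^{|λ|} t^{b(λ')} t^{b(λ)}; together with u^{Σ (n+c(x))} it converts the
-- weight (u/t)^{b(λ)} into t^ℓ u^{nℓ} (ut)^{b(λ')}.
-- Hence every summand satisfies  term_n(u,1/t,λ) = (t u^n)^ℓ term_{−n}(u,t,λ'),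
-- and since conjugation permutes the partitions of ℓ the sums agree up to
-- (t u^n)^ℓ.  The prefactors are matched by
--   t^(ℓ choose 2) t^ℓ (1/t; 1/t)_ℓ = (−1)^ℓ (t; t)_ℓ.
module Submission where

open import Defs
open import Data.Nat using (ℕ; _≤_; _<_)
open import Data.Integer using (ℤ)
import Data.Integer
open import Data.Rational using (ℚ; 0ℚ; 1ℚ; _*_; -_)
open import Relation.Binary.PropositionalEquality using (_≡_; _≢_)

open import Data.Nat as ℕ using (zero; suc; _∸_; _⊓_; z≤n; s≤s; _<?_; _≤?_)
import Data.Nat.Properties as ℕP
open import Data.Nat.ListAction using (sum)
open import Data.Integer as ℤ using (+_; -[1+_])
import Data.Integer.Properties as ℤP
import Data.Integer.Solver as ℤSolver
open import Data.Rational as ℚ using (_+_; _-_)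
import Data.Rational.Properties as ℚP
open import Data.Rational.Properties using (*-assoc; *-comm; *-identityˡ; *-identityʳ)
open import Data.Rational.Solver using (module +-*-Solver)
open import Data.List using (List; []; _∷_; map; foldr; upTo; applyUpTo; concatMap; _++_; length; filter)
import Data.List.Properties as LP
open import Data.List.Membership.Propositional using (_∈_; find; lose)
open import Data.List.Membership.Propositional.Properties using (∈-map⁺; ∈-map⁻; ∈-upTo⁺; ∈-upTo⁻; ∈-concatMap⁺; ∈-concatMap⁻)
open import Data.List.Membership.Propositional.Properties.WithK using (unique∧set⇒bag)
open import Data.List.Relation.Unary.Any using (here; there)
import Data.List.Relation.Unary.All as All
open import Data.List.Relation.Unary.AllPairs using ([]; _∷_)
open import Data.List.Relation.Unary.Unique.Propositional using (Unique)
import Data.List.Relation.Unary.Unique.Propositional.Properties as Unique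
open import Data.List.Relation.Binary.Permutation.Propositional using (_↭_; ↭⇒↭ₛ)
import Data.List.Relation.Binary.Permutation.Propositional.Properties as Perm
import Data.List.Relation.Binary.Permutation.Setoid.Properties as PermSetoid
open import Data.List.Relation.Binary.BagAndSetEquality using (∼bag⇒↭)
open import Algebra.Structures using (IsCommutativeMonoid)
open import Data.Product using (_×_; _,_)
open import Data.Empty using (⊥-elim)
open import Function using (_∘_)
open import Function.Bundles using (mk⇔)
open import Relation.Nullary using (yes; no; Dec)
open import Relation.Binary.PropositionalEquality
  using (refl; sym; trans; cong; cong₂; subst; setoid; module ≡-Reasoning)

inv-l : ∀ q → q ≢ 0ℚ → inv q * q ≡ 1ℚ
inv-l q q≢0 with q ℚP.≟ 0ℚ
... | yes q≡0 = ⊥-elim (q≢0 q≡0)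
... | no q≢0′ = ℚP.*-inverseˡ q {{ℚ.≢-nonZero q≢0′}}

inv-r : ∀ q → q ≢ 0ℚ → q * inv q ≡ 1ℚ
inv-r q q≢0 = trans (*-comm q (inv q)) (inv-l q q≢0)

inv-unique : ∀ q r → q ≢ 0ℚ → q * r ≡ 1ℚ → inv q ≡ r
inv-unique q r q≢0 qr = begin
  inv q            ≡⟨ sym (*-identityʳ _) ⟩
  inv q * 1ℚ       ≡⟨ cong (inv q *_) (sym qr) ⟩
  inv q * (q * r)  ≡⟨ sym (*-assoc (inv q) q r) ⟩
  (inv q * q) * r  ≡⟨ cong (_* r) (inv-l q q≢0) ⟩
  1ℚ * r           ≡⟨ *-identityˡ r ⟩
  r                ∎
  where open ≡-Reasoning

1≢0 : 1ℚ ≢ 0ℚ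
1≢0 ()

*-nonzero : ∀ p q → p ≢ 0ℚ → q ≢ 0ℚ → p * q ≢ 0ℚ
*-nonzero p q p≢0 q≢0 pq≡0 = q≢0 (begin
  q                ≡⟨ sym (*-identityˡ q) ⟩
  1ℚ * q           ≡⟨ cong (_* q) (sym (inv-l p p≢0)) ⟩
  (inv p * p) * q  ≡⟨ *-assoc (inv p) p q ⟩
  inv p * (p * q)  ≡⟨ cong (inv p *_) pq≡0 ⟩
  inv p * 0ℚ       ≡⟨ ℚP.*-zeroʳ (inv p) ⟩
  0ℚ               ∎)
  where open ≡-Reasoning

inv-nonzero : ∀ q → q ≢ 0ℚ → inv q ≢ 0ℚ
inv-nonzero q q≢0 e = 1≢0 (trans (sym (inv-l q q≢0)) (trans (cong (_* q) e) (ℚP.*-zeroˡ q)))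

inv-* : ∀ p q → p ≢ 0ℚ → q ≢ 0ℚ → inv (p * q) ≡ inv p * inv q
inv-* p q p≢0 q≢0 = inv-unique (p * q) _ (*-nonzero p q p≢0 q≢0) (begin
  (p * q) * (inv p * inv q)  ≡⟨ solve 4 (λ a b c d → (a :* b) :* (c :* d) := (a :* c) :* (b :* d))
                                   refl p q (inv p) (inv q) ⟩
  (p * inv p) * (q * inv q)  ≡⟨ cong₂ _*_ (inv-r p p≢0) (inv-r q q≢0) ⟩
  1ℚ                         ∎)
  where
  open ≡-Reasoning
  open +-*-Solver

inv-inv : ∀ q → q ≢ 0ℚ → inv (inv q) ≡ q
inv-inv q q≢0 = inv-unique (inv q) q (inv-nonzero q q≢0) (inv-l q q≢0)

cross-multiply : ∀ a b c d → b ≢ 0ℚ → d ≢ 0ℚ → a * d ≡ c * b → a * inv b ≡ c * inv d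
cross-multiply a b c d b≢0 d≢0 ad≡cb = begin
  a * inv b                  ≡⟨ sym (*-identityʳ _) ⟩
  (a * inv b) * 1ℚ           ≡⟨ cong ((a * inv b) *_) (sym (inv-r d d≢0)) ⟩
  (a * inv b) * (d * inv d)  ≡⟨ solve 4 (λ a b d e → (a :* b) :* (d :* e) := (a :* d) :* (b :* e))
                                   refl a (inv b) d (inv d) ⟩
  (a * d) * (inv b * inv d)  ≡⟨ cong (_* (inv b * inv d)) ad≡cb ⟩
  (c * b) * (inv b * inv d)  ≡⟨ solve 4 (λ c b e f → (c :* b) :* (e :* f) := (c :* f) :* (b :* e))
                                   refl c b (inv b) (inv d) ⟩
  (c * inv d) * (b * inv b)  ≡⟨ cong ((c * inv d) *_) (inv-r b b≢0) ⟩
  (c * inv d) * 1ℚ           ≡⟨ *-identityʳ _ ⟩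
  c * inv d                  ∎
  where
  open ≡-Reasoning
  open +-*-Solver

1-x≢0 : ∀ x → x ≢ 1ℚ → 1ℚ - x ≢ 0ℚ
1-x≢0 x x≢1 e = x≢1 (sym (begin
  1ℚ            ≡⟨ solve 1 (λ x → con 1ℚ := (con 1ℚ :- x) :+ x) refl x ⟩
  (1ℚ - x) + x  ≡⟨ cong (_+ x) e ⟩
  0ℚ + x        ≡⟨ ℚP.+-identityˡ x ⟩
  x             ∎))
  where
  open ≡-Reasoning
  open +-*-Solver

^-nonzero : ∀ q k → q ≢ 0ℚ → q ^ k ≢ 0ℚ
^-nonzero q zero q≢0 = 1≢0
^-nonzero q (suc k) q≢0 = *-nonzero q (q ^ k) q≢0 (^-nonzero q k q≢0)

^-+ : ∀ q a b → q ^ (a ℕ.+ b) ≡ q ^ a * q ^ b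
^-+ q zero b = sym (*-identityˡ _)
^-+ q (suc a) b = trans (cong (q *_) (^-+ q a b)) (sym (*-assoc q (q ^ a) (q ^ b)))

^-* : ∀ q a b → q ^ (a ℕ.* b) ≡ (q ^ a) ^ b
^-* q a zero rewrite ℕP.*-zeroʳ a = refl
^-* q a (suc b) = begin
  q ^ (a ℕ.* suc b)        ≡⟨ cong (q ^_) (ℕP.*-suc a b) ⟩
  q ^ (a ℕ.+ a ℕ.* b)      ≡⟨ ^-+ q a (a ℕ.* b) ⟩
  q ^ a * q ^ (a ℕ.* b)    ≡⟨ cong (q ^ a *_) (^-* q a b) ⟩
  (q ^ a) ^ suc b          ∎
  where open ≡-Reasoning

*-^ : ∀ p q k → (p * q) ^ k ≡ p ^ k * q ^ k
*-^ p q zero = refl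
*-^ p q (suc k) = trans (cong ((p * q) *_) (*-^ p q k))
  (solve 4 (λ a b c d → (a :* b) :* (c :* d) := (a :* c) :* (b :* d)) refl p q (p ^ k) (q ^ k))
  where open +-*-Solver

^-inverse : ∀ t s k → t * s ≡ 1ℚ → t ^ k * s ^ k ≡ 1ℚ
^-inverse t s k ts≡1 = trans (sym (*-^ t s k)) (trans (cong (_^ k) ts≡1) (1^ k))
  where
  1^ : ∀ k → 1ℚ ^ k ≡ 1ℚ
  1^ zero = refl
  1^ (suc k) = trans (*-identityˡ _) (1^ k)

^ᶻ-nonzero : ∀ q z → q ≢ 0ℚ → q ^ᶻ z ≢ 0ℚ
^ᶻ-nonzero q (+ k) q≢0 = ^-nonzero q k q≢0
^ᶻ-nonzero q -[1+ k ] q≢0 = inv-nonzero _ (^-nonzero q (suc k) q≢0)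

^ᶻ-+ : ∀ q z k → q ≢ 0ℚ → q ^ᶻ (z ℤ.+ + k) ≡ q ^ᶻ z * q ^ k
^ᶻ-+ q z zero q≢0 = trans (cong (q ^ᶻ_) (ℤP.+-identityʳ z)) (sym (*-identityʳ _))
^ᶻ-+ q z (suc k) q≢0 = begin
  q ^ᶻ (z ℤ.+ + suc k)          ≡⟨ cong (q ^ᶻ_) (sym (ℤP.+-assoc z (+ 1) (+ k))) ⟩
  q ^ᶻ ((z ℤ.+ + 1) ℤ.+ + k)    ≡⟨ ^ᶻ-+ q (z ℤ.+ + 1) k q≢0 ⟩
  q ^ᶻ (z ℤ.+ + 1) * q ^ k      ≡⟨ cong (_* q ^ k) (^ᶻ-suc z) ⟩
  (q ^ᶻ z * q) * q ^ k          ≡⟨ *-assoc (q ^ᶻ z) q (q ^ k) ⟩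
  q ^ᶻ z * q ^ suc k            ∎
  where
  open ≡-Reasoning
  open +-*-Solver
  ^ᶻ-suc : ∀ z → q ^ᶻ (z ℤ.+ + 1) ≡ q ^ᶻ z * q
  ^ᶻ-suc (+ k) = trans (cong (q ^_) (ℕP.+-comm k 1)) (*-comm q (q ^ k))
  ^ᶻ-suc -[1+ zero ] = sym (begin
    inv (q * 1ℚ) * q  ≡⟨ cong (λ x → inv x * q) (*-identityʳ q) ⟩
    inv q * q         ≡⟨ inv-l q q≢0 ⟩
    1ℚ                ∎)
  ^ᶻ-suc -[1+ suc k ] = sym (begin
    inv (q * q ^ suc k) * q          ≡⟨ cong (_* q) (inv-* q _ q≢0 (^-nonzero q (suc k) q≢0)) ⟩
    (inv q * inv (q ^ suc k)) * q    ≡⟨ solve 3 (λ a b c → (a :* b) :* c := (c :* a) :* b)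
                                          refl (inv q) (inv (q ^ suc k)) q ⟩
    (q * inv q) * inv (q ^ suc k)    ≡⟨ cong (_* inv (q ^ suc k)) (inv-r q q≢0) ⟩
    1ℚ * inv (q ^ suc k)             ≡⟨ *-identityˡ _ ⟩
    inv (q ^ suc k)                  ∎)

^ᶻ-neg : ∀ q z → q ≢ 0ℚ → q ^ᶻ (ℤ.- z) ≡ inv (q ^ᶻ z)
^ᶻ-neg q (+ zero) q≢0 = sym (inv-unique 1ℚ 1ℚ 1≢0 refl)
^ᶻ-neg q (+ suc k) q≢0 = refl
^ᶻ-neg q -[1+ k ] q≢0 = sym (inv-inv _ (^-nonzero q (suc k) q≢0))

module BigOp {A : Set} {_∙_ : A → A → A} {ε : A}
             (isCM : IsCommutativeMonoid _≡_ _∙_ ε) where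
  open IsCommutativeMonoid isCM using (assoc; comm; identityˡ)
  open ≡-Reasoning

  big : List A → A
  big = foldr _∙_ ε

  Π : ℕ → (ℕ → A) → A
  Π n f = big (applyUpTo f n)

  big-upTo : ∀ (f : ℕ → A) n → big (map f (upTo n)) ≡ Π n f
  big-upTo f n = cong big (LP.map-upTo f n)

  big-++ : ∀ xs ys → big (xs ++ ys) ≡ big xs ∙ big ys
  big-++ [] ys = sym (identityˡ _)
  big-++ (x ∷ xs) ys = trans (cong (x ∙_) (big-++ xs ys)) (sym (assoc x (big xs) (big ys)))

  big-concatMap : ∀ {B C : Set} (G : C → A) (h : B → List C) xs →
    big (map G (concatMap h xs)) ≡ big (map (λ x → big (map G (h x))) xs)
  big-concatMap G h [] = refl
  big-concatMap G h (x ∷ xs) = begin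
    big (map G (h x ++ concatMap h xs))                ≡⟨ cong big (LP.map-++ G (h x) (concatMap h xs)) ⟩
    big (map G (h x) ++ map G (concatMap h xs))        ≡⟨ big-++ (map G (h x)) _ ⟩
    big (map G (h x)) ∙ big (map G (concatMap h xs))   ≡⟨ cong (big (map G (h x)) ∙_) (big-concatMap G h xs) ⟩
    big (map G (h x)) ∙ big (map (λ x → big (map G (h x))) xs) ∎

  Π-ext : ∀ n {f g : ℕ → A} → (∀ i → i < n → f i ≡ g i) → Π n f ≡ Π n g
  Π-ext zero e = refl
  Π-ext (suc n) e = cong₂ _∙_ (e 0 (s≤s z≤n)) (Π-ext n (λ i i<n → e (suc i) (s≤s i<n)))

  Π-ε : ∀ n → Π n (λ _ → ε) ≡ ε
  Π-ε zero = refl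
  Π-ε (suc n) = trans (identityˡ _) (Π-ε n)

  Π-∙ : ∀ n (f g : ℕ → A) → Π n (λ i → f i ∙ g i) ≡ Π n f ∙ Π n g
  Π-∙ zero f g = sym (identityˡ ε)
  Π-∙ (suc n) f g = begin
    (f 0 ∙ g 0) ∙ Π n (λ i → f (suc i) ∙ g (suc i))  ≡⟨ cong ((f 0 ∙ g 0) ∙_) (Π-∙ n (f ∘ suc) (g ∘ suc)) ⟩
    (f 0 ∙ g 0) ∙ (Π n (f ∘ suc) ∙ Π n (g ∘ suc))    ≡⟨ interchange (f 0) (g 0) _ _ ⟩
    (f 0 ∙ Π n (f ∘ suc)) ∙ (g 0 ∙ Π n (g ∘ suc))    ∎
    where
    interchange : ∀ a b c d → (a ∙ b) ∙ (c ∙ d) ≡ (a ∙ c) ∙ (b ∙ d)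
    interchange a b c d = begin
      (a ∙ b) ∙ (c ∙ d)  ≡⟨ assoc a b (c ∙ d) ⟩
      a ∙ (b ∙ (c ∙ d))  ≡⟨ cong (a ∙_) (sym (assoc b c d)) ⟩
      a ∙ ((b ∙ c) ∙ d)  ≡⟨ cong (λ x → a ∙ (x ∙ d)) (comm b c) ⟩
      a ∙ ((c ∙ b) ∙ d)  ≡⟨ cong (a ∙_) (assoc c b d) ⟩
      a ∙ (c ∙ (b ∙ d))  ≡⟨ sym (assoc a c (b ∙ d)) ⟩
      (a ∙ c) ∙ (b ∙ d)  ∎

  Π-swap : ∀ n m (f : ℕ → ℕ → A) → Π n (λ i → Π m (f i)) ≡ Π m (λ j → Π n (λ i → f i j))
  Π-swap zero m f = sym (Π-ε m)
  Π-swap (suc n) m f = begin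
    Π m (f 0) ∙ Π n (λ i → Π m (f (suc i)))           ≡⟨ cong (Π m (f 0) ∙_) (Π-swap n m (f ∘ suc)) ⟩
    Π m (f 0) ∙ Π m (λ j → Π n (λ i → f (suc i) j))   ≡⟨ sym (Π-∙ m (f 0) _) ⟩
    Π m (λ j → Π (suc n) (λ i → f i j))               ∎

  Π-trunc : ∀ k n (f : ℕ → A) → k ≤ n → (∀ i → k ≤ i → i < n → f i ≡ ε) → Π n f ≡ Π k f
  Π-trunc zero n f _ e = trans (Π-ext n (λ i i<n → e i z≤n i<n)) (Π-ε n)
  Π-trunc (suc k) (suc n) f (s≤s k≤n) e =
    cong (f 0 ∙_) (Π-trunc k n (f ∘ suc) k≤n (λ i k≤i i<n → e (suc i) (s≤s k≤i) (s≤s i<n)))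

  Π-snoc : ∀ n (f : ℕ → A) → Π (suc n) f ≡ Π n f ∙ f n
  Π-snoc zero f = comm (f 0) ε
  Π-snoc (suc n) f = trans (cong (f 0 ∙_) (Π-snoc n (f ∘ suc))) (sym (assoc (f 0) _ _))

  Π-rev : ∀ k (f : ℕ → A) → Π k (λ j → f (k ∸ suc j)) ≡ Π k f
  Π-rev zero f = refl
  Π-rev (suc k) f = begin
    f k ∙ Π k (λ j → f (k ∸ suc j))  ≡⟨ cong (f k ∙_) (Π-rev k f) ⟩
    f k ∙ Π k f                      ≡⟨ comm (f k) _ ⟩
    Π k f ∙ f k                      ≡⟨ sym (Π-snoc k f) ⟩
    Π (suc k) f                      ∎

  ind : {P : Set} → Dec P → A → A
  ind (yes _) x = x
  ind (no _) _ = ε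

  ind-ext : ∀ {P : Set} (d : Dec P) {x y} → (P → x ≡ y) → ind d x ≡ ind d y
  ind-ext (yes p) e = e p
  ind-ext (no _) e = refl

  ind-∙ : ∀ {P : Set} (d : Dec P) x y → ind d (x ∙ y) ≡ ind d x ∙ ind d y
  ind-∙ (yes _) x y = refl
  ind-∙ (no _) x y = sym (identityˡ ε)

  ind-iff : ∀ {P Q : Set} (d : Dec P) (e : Dec Q) x → (P → Q) → (Q → P) → ind d x ≡ ind e x
  ind-iff (yes _) (yes _) x f g = refl
  ind-iff (yes p) (no ¬q) x f g = ⊥-elim (¬q (f p))
  ind-iff (no ¬p) (yes q) x f g = ⊥-elim (¬p (g q))
  ind-iff (no _) (no _) x f g = refl

  Π-ind : ∀ k n (f : ℕ → A) → k ≤ n → Π n (λ j → ind (j <? k) (f j)) ≡ Π k f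
  Π-ind k n f k≤n = trans (Π-trunc k n _ k≤n (λ i k≤i _ → outside i k≤i))
                          (Π-ext k (λ i i<k → inside i i<k))
    where
    outside : ∀ i → k ≤ i → ind (i <? k) (f i) ≡ ε
    outside i k≤i with i <? k
    ... | yes i<k = ⊥-elim (ℕP.<⇒≱ i<k k≤i)
    ... | no _ = refl
    inside : ∀ i → i < k → ind (i <? k) (f i) ≡ f i
    inside i i<k with i <? k
    ... | yes _ = refl
    ... | no i≮k = ⊥-elim (i≮k i<k)

  pow : A → ℕ → A
  pow x n = Π n (λ _ → x)

  pow-+ : ∀ x a b → pow x (a ℕ.+ b) ≡ pow x a ∙ pow x b
  pow-+ x zero b = sym (identityˡ _)
  pow-+ x (suc a) b = trans (cong (x ∙_) (pow-+ x a b)) (sym (assoc x _ _))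

data Partition≤ : ℕ → List ℕ → Set where
  [] : ∀ {m} → Partition≤ m []
  cons : ∀ {m p ps} → 1 ≤ p → p ≤ m → Partition≤ p ps → Partition≤ m (p ∷ ps)

part-bound : ∀ {m xs} → Partition≤ m xs → ∀ r → part xs r ≤ m
part-bound [] r = z≤n
part-bound (cons _ _ _) zero = z≤n
part-bound (cons _ p≤m _) (suc zero) = p≤m
part-bound (cons _ p≤m d) (suc (suc r)) = ℕP.≤-trans (part-bound d (suc r)) p≤m

part-beyond : ∀ xs i → length xs ≤ i → part xs (suc i) ≡ 0
part-beyond [] i _ = refl
part-beyond (x ∷ xs) (suc i) (s≤s le) = part-beyond xs i le

Partition≤-ext : ∀ {m m′ xs ys} → Partition≤ m xs → Partition≤ m′ ys →
  (∀ r → part xs (suc r) ≡ part ys (suc r)) → xs ≡ ys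
Partition≤-ext [] [] e = refl
Partition≤-ext [] (cons 1≤p _ _) e = ⊥-elim (ℕP.<⇒≢ 1≤p (e 0))
Partition≤-ext (cons 1≤p _ _) [] e = ⊥-elim (ℕP.<⇒≢ 1≤p (sym (e 0)))
Partition≤-ext (cons _ _ d) (cons _ _ d′) e = cong₂ _∷_ (e 0) (Partition≤-ext d d′ (e ∘ suc))

Partition≤-applyUpTo : ∀ m (f : ℕ → ℕ) M → (∀ j → suc j < M → f (suc j) ≤ f j) →
  (∀ j → j < M → 1 ≤ f j) → (∀ j → j < M → f j ≤ m) → Partition≤ m (applyUpTo f M)
Partition≤-applyUpTo m f zero _ _ _ = []
Partition≤-applyUpTo m f (suc M) dec pos bd =
  cons (pos 0 (s≤s z≤n)) (bd 0 (s≤s z≤n))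
       (Partition≤-applyUpTo (f 0) (f ∘ suc) M (λ j lt → dec (suc j) (s≤s lt))
                             (λ j lt → pos (suc j) (s≤s lt)) below-head)
  where
  below-head : ∀ j → j < M → f (suc j) ≤ f 0
  below-head zero lt = dec 0 (s≤s lt)
  below-head (suc j) lt = ℕP.≤-trans (dec (suc j) (s≤s lt)) (below-head j (ℕP.<-trans (ℕP.n<1+n j) lt))

len≤sum : ∀ {m xs} → Partition≤ m xs → length xs ≤ sum xs
len≤sum [] = z≤n
len≤sum (cons 1≤p _ d) = ℕP.+-mono-≤ 1≤p (len≤sum d)

column : ℕ → List ℕ → ℕ
column J [] = 0
column J (p ∷ ps) with J ≤? p
... | yes _ = suc (column J ps)
... | no _ = 0

column-len : ∀ J xs → column J xs ≤ length xs
column-len J [] = z≤n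
column-len J (p ∷ ps) with J ≤? p
... | yes _ = s≤s (column-len J ps)
... | no _ = z≤n

column-beyond : ∀ J xs → part xs 1 < J → column J xs ≡ 0
column-beyond J [] _ = refl
column-beyond J (p ∷ ps) lt with J ≤? p
... | yes J≤p = ⊥-elim (ℕP.<⇒≱ lt J≤p)
... | no _ = refl

column-mono : ∀ {J J′} xs → J ≤ J′ → column J′ xs ≤ column J xs
column-mono [] le = z≤n
column-mono {J} {J′} (p ∷ ps) le with J′ ≤? p | J ≤? p
... | yes _ | yes _ = s≤s (column-mono ps le)
... | yes J′≤p | no J≰p = ⊥-elim (J≰p (ℕP.≤-trans le J′≤p))
... | no _ | _ = z≤n

column-galois→ : ∀ {m xs} → Partition≤ m xs → ∀ J r → 1 ≤ J → J ≤ part xs (suc r) → r < column J xs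
column-galois→ [] J r 1≤J le = ⊥-elim (ℕP.<⇒≱ 1≤J le)
column-galois→ (cons {p = p} _ _ d) J zero _ le with J ≤? p
... | yes _ = s≤s z≤n
... | no J≰p = ⊥-elim (J≰p le)
column-galois→ (cons {p = p} _ _ d) J (suc r) 1≤J le with J ≤? p
... | yes _ = s≤s (column-galois→ d J r 1≤J le)
... | no J≰p = ⊥-elim (J≰p (ℕP.≤-trans le (part-bound d (suc r))))

column-galois← : ∀ {m xs} → Partition≤ m xs → ∀ J r → r < column J xs → J ≤ part xs (suc r)
column-galois← (cons {p = p} _ _ d) J r lt with J ≤? p
column-galois← (cons _ _ d) J zero lt | yes J≤p = J≤p
column-galois← (cons _ _ d) J (suc r) (s≤s lt) | yes _ = column-galois← d J r lt

conj : List ℕ → List ℕ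
conj xs = applyUpTo (λ j → column (suc j) xs) (part xs 1)

conj-part : ∀ xs j → part (conj xs) (suc j) ≡ column (suc j) xs
conj-part xs j with j <? part xs 1
... | yes lt = part-applyUpTo (λ j → column (suc j) xs) (part xs 1) j lt
  where
  part-applyUpTo : ∀ (f : ℕ → ℕ) M j → j < M → part (applyUpTo f M) (suc j) ≡ f j
  part-applyUpTo f (suc M) zero _ = refl
  part-applyUpTo f (suc M) (suc j) (s≤s lt) = part-applyUpTo (f ∘ suc) M j lt
... | no ¬lt = trans (part-beyond (conj xs) j len≤j) (sym (column-beyond (suc j) xs (s≤s (ℕP.≮⇒≥ ¬lt))))
  where
  len≤j : length (conj xs) ≤ j
  len≤j = subst (_≤ j) (sym (LP.length-applyUpTo _ (part xs 1))) (ℕP.≮⇒≥ ¬lt)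

conj-length : ∀ {m xs} → Partition≤ m xs → length (conj xs) ≤ m
conj-length {xs = xs} d = ℕP.≤-trans (ℕP.≤-reflexive (LP.length-applyUpTo _ (part xs 1))) (part-bound d 1)

conj-Partition≤ : ∀ {m xs} m′ → Partition≤ m xs → length xs ≤ m′ → Partition≤ m′ (conj xs)
conj-Partition≤ {xs = xs} m′ d le = Partition≤-applyUpTo m′ _ (part xs 1)
  (λ j _ → column-mono xs (ℕP.n≤1+n (suc j)))
  (λ j lt → column-galois→ d (suc j) 0 (s≤s z≤n) lt)
  (λ j _ → ℕP.≤-trans (column-len (suc j) xs) le)

conj-cell→ : ∀ {m xs} → Partition≤ m xs → ∀ i j → j < part xs (suc i) → i < part (conj xs) (suc j)
conj-cell→ {xs = xs} d i j lt = subst (i <_) (sym (conj-part xs j)) (column-galois→ d (suc j) i (s≤s z≤n) lt)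

conj-cell← : ∀ {m xs} → Partition≤ m xs → ∀ i j → i < part (conj xs) (suc j) → j < part xs (suc i)
conj-cell← {xs = xs} d i j lt = column-galois← d (suc j) i (subst (i <_) (conj-part xs j) lt)

conj-conj : ∀ {m xs} → Partition≤ m xs → length xs ≤ m → conj (conj xs) ≡ xs
conj-conj {m} {xs} d le = Partition≤-ext (conj-Partition≤ m d′ (conj-length d)) d λ r →
  trans (conj-part (conj xs) r) (same-lower-set
    (λ i lt → conj-cell← d r i (column-galois← d′ (suc r) i lt))
    (λ i lt → column-galois→ d′ (suc r) i (s≤s z≤n) (conj-cell→ d r i lt)))
  where
  d′ = conj-Partition≤ m d le
  same-lower-set : ∀ {a b} → (∀ r → r < a → r < b) → (∀ r → r < b → r < a) → a ≡ b
  same-lower-set {a} {b} f g = ℕP.≤-antisym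
    (ℕP.≮⇒≥ (λ b<a → ℕP.<-irrefl refl (f b b<a)))
    (ℕP.≮⇒≥ (λ a<b → ℕP.<-irrefl refl (g a a<b)))

-- Products over the cells of a Young diagram, written as a product over the
-- N×N box with indicators so that the two orders of summation (rows first or
-- columns first) are available.  Cells are 0-indexed: (i,j) ∈ xs iff j < xs_{i+1}.
module Diagram {A : Set} {_∙_ : A → A → A} {ε : A}
               (isCM : IsCommutativeMonoid _≡_ _∙_ ε) where
  open BigOp isCM public
  open IsCommutativeMonoid isCM using (identityˡ)
  open ≡-Reasoning

  Πλ : List ℕ → ℕ → (ℕ → ℕ → A) → A
  Πλ xs N G = Π N (λ i → Π N (λ j → ind (j <? part xs (suc i)) (G i j)))

  Πλ-rows : ∀ {N xs} → Partition≤ N xs → length xs ≤ N → ∀ G →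
    Π (length xs) (λ i → Π (part xs (suc i)) (G i)) ≡ Πλ xs N G
  Πλ-rows {N} {xs} d le G = sym (trans
    (Π-trunc (length xs) N _ le (λ i l≤i _ → empty-row i (part-beyond xs i l≤i)))
    (Π-ext (length xs) (λ i _ → Π-ind (part xs (suc i)) N (G i) (part-bound d (suc i)))))
    where
    empty-row : ∀ i → part xs (suc i) ≡ 0 → Π N (λ j → ind (j <? part xs (suc i)) (G i j)) ≡ ε
    empty-row i e rewrite e = Π-ind 0 N (G i) z≤n

  Πλ-ext : ∀ xs N {G G′ : ℕ → ℕ → A} → (∀ i j → j < part xs (suc i) → G i j ≡ G′ i j) →
    Πλ xs N G ≡ Πλ xs N G′
  Πλ-ext xs N e = Π-ext N (λ i _ → Π-ext N (λ j _ → ind-ext (j <? part xs (suc i)) (e i j)))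

  Πλ-∙ : ∀ xs N (G G′ : ℕ → ℕ → A) → Πλ xs N (λ i j → G i j ∙ G′ i j) ≡ Πλ xs N G ∙ Πλ xs N G′
  Πλ-∙ xs N G G′ = trans
    (Π-ext N (λ i _ → trans (Π-ext N (λ j _ → ind-∙ (j <? part xs (suc i)) (G i j) (G′ i j))) (Π-∙ N _ _)))
    (Π-∙ N _ _)

  Πλ-conj : ∀ {m xs} → Partition≤ m xs → ∀ N (H : ℕ → ℕ → A) → Πλ (conj xs) N H ≡ Πλ xs N (λ i j → H j i)
  Πλ-conj {xs = xs} d N H = trans (Π-swap N N _)
    (Π-ext N (λ i _ → Π-ext N (λ j _ →
      ind-iff (i <? part (conj xs) (suc j)) (j <? part xs (suc i)) (H j i) (conj-cell← d i j) (conj-cell→ d i j))))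

  -- Reversing every row: the arm length λ_i − 1 − j runs over the same values as j.
  Πλ-rev : ∀ {N xs} → Partition≤ N xs → length xs ≤ N → ∀ (φ : ℕ → A) →
    Πλ xs N (λ i j → φ (part xs (suc i) ∸ suc j)) ≡ Πλ xs N (λ i j → φ j)
  Πλ-rev {xs = xs} d le φ = trans (sym (Πλ-rows d le _))
    (trans (Π-ext (length xs) (λ i _ → Π-rev (part xs (suc i)) φ)) (Πλ-rows d le _))

  Πλ-const : ∀ {N xs} → Partition≤ N xs → length xs ≤ N → ∀ x → Πλ xs N (λ _ _ → x) ≡ pow x (sum xs)
  Πλ-const {xs = xs} d le x = trans (sym (Πλ-rows d le _)) (rows-pow xs)
    where
    rows-pow : ∀ xs → Π (length xs) (λ i → pow x (part xs (suc i))) ≡ pow x (sum xs)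
    rows-pow [] = refl
    rows-pow (p ∷ ps) = trans (cong (pow x p ∙_) (rows-pow ps)) (sym (pow-+ x p (sum ps)))

module ℕDiagram = Diagram ℕP.+-0-isCommutativeMonoid
module ℚDiagram = Diagram ℚP.*-1-isCommutativeMonoid

-- Conjugation preserves the size: count the cells of λ' by columns of λ.
sum-conj : ∀ {N xs} → Partition≤ N xs → length xs ≤ N → sum (conj xs) ≡ sum xs
sum-conj {N} {xs} d le = begin
  sum (conj xs)                     ≡⟨ sym (pow1 _) ⟩
  pow 1 (sum (conj xs))             ≡⟨ sym (Πλ-const (conj-Partition≤ N d le) (conj-length d) 1) ⟩
  Πλ (conj xs) N (λ _ _ → 1)        ≡⟨ Πλ-conj d N _ ⟩
  Πλ xs N (λ _ _ → 1)               ≡⟨ Πλ-const d le 1 ⟩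
  pow 1 (sum xs)                    ≡⟨ pow1 _ ⟩
  sum xs                            ∎
  where
  open ≡-Reasoning
  open ℕDiagram using (Πλ; Πλ-const; Πλ-conj; pow)
  pow1 : ∀ k → pow 1 k ≡ k
  pow1 zero = refl
  pow1 (suc k) = cong suc (pow1 k)

applyUpTo-cong : ∀ {B : Set} {f g : ℕ → B} → (∀ i → f i ≡ g i) → ∀ n → applyUpTo f n ≡ applyUpTo g n
applyUpTo-cong {f = f} {g} e n = trans (sym (LP.map-upTo f n)) (trans (LP.map-cong e (upTo n)) (LP.map-upTo g n))

rows-reaching : ∀ {m xs} → Partition≤ m xs → ∀ J → 1 ≤ J → ∀ a M →
  length (filter (λ r → J ≤? part xs r) (applyUpTo (λ k → suc (k ℕ.+ a)) M)) ≡ (column J xs ∸ a) ⊓ M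
rows-reaching d J 1≤J a zero = sym (ℕP.⊓-zeroʳ _)
rows-reaching {xs = xs} d J 1≤J a (suc M) = by-first-row (J ≤? part xs (suc a))
  where
  open ≡-Reasoning
  reaches? = λ r → J ≤? part xs r
  later = applyUpTo (λ k → suc (suc k ℕ.+ a)) M
  rest : length (filter reaches? later) ≡ (column J xs ∸ suc a) ⊓ M
  rest = trans (cong (length ∘ filter reaches?) (applyUpTo-cong (λ k → cong suc (sym (ℕP.+-suc k a))) M))
               (rows-reaching d J 1≤J (suc a) M)
  by-first-row : Dec (J ≤ part xs (suc a)) →
    length (filter reaches? (suc a ∷ later)) ≡ (column J xs ∸ a) ⊓ suc M
  by-first-row (yes J≤) = begin
    length (filter reaches? (suc a ∷ later))  ≡⟨ cong length (LP.filter-accept reaches? J≤) ⟩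
    suc (length (filter reaches? later))      ≡⟨ cong suc rest ⟩
    suc ((column J xs ∸ suc a) ⊓ M)           ≡⟨ cong (_⊓ suc M) (sym (ℕP.+-∸-assoc 1 (column-galois→ d J a 1≤J J≤))) ⟩
    (column J xs ∸ a) ⊓ suc M                 ∎
  by-first-row (no J≰) = begin
    length (filter reaches? (suc a ∷ later))  ≡⟨ cong length (LP.filter-reject reaches? J≰) ⟩
    length (filter reaches? later)            ≡⟨ rest ⟩
    (column J xs ∸ suc a) ⊓ M                 ≡⟨ cong (_⊓ M) (ℕP.m≤n⇒m∸n≡0 (ℕP.≤-trans column≤a (ℕP.n≤1+n a))) ⟩
    0                                         ≡⟨ cong (_⊓ suc M) (sym (ℕP.m≤n⇒m∸n≡0 column≤a)) ⟩
    (column J xs ∸ a) ⊓ suc M                 ∎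
    where
    column≤a : column J xs ≤ a
    column≤a = ℕP.≮⇒≥ (λ lt → J≰ (column-galois← d J a lt))

arm leg : List ℕ → ℕ → ℕ → ℕ
arm xs i j = part xs (suc i) ∸ suc j
leg xs i j = part (conj xs) (suc j) ∸ suc i

hook-arm-leg : ∀ {m xs} → Partition≤ m xs → ∀ i j →
  hook xs (suc i , suc j) ≡ suc (arm xs i j ℕ.+ leg xs i j)
hook-arm-leg {xs = xs} d i j = cong (λ l → suc (arm xs i j ℕ.+ l)) (begin
  length (filter reaches? (map (λ k → suc i ℕ.+ suc k) (upTo L)))   ≡⟨ cong (length ∘ filter reaches?) below ⟩
  length (filter reaches? (applyUpTo (λ k → suc (k ℕ.+ suc i)) L))  ≡⟨ rows-reaching d (suc j) (s≤s z≤n) (suc i) L ⟩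
  (column (suc j) xs ∸ suc i) ⊓ L                                  ≡⟨ ℕP.m≤n⇒m⊓n≡m (ℕP.∸-monoˡ-≤ (suc i) (column-len (suc j) xs)) ⟩
  column (suc j) xs ∸ suc i                                        ≡⟨ cong (_∸ suc i) (sym (conj-part xs j)) ⟩
  leg xs i j                                                       ∎)
  where
  open ≡-Reasoning
  reaches? = λ r → suc j ≤? part xs r
  L = length xs ∸ suc i
  below : map (λ k → suc i ℕ.+ suc k) (upTo L) ≡ applyUpTo (λ k → suc (k ℕ.+ suc i)) L
  below = trans (LP.map-upTo _ L)
    (applyUpTo-cong (λ k → cong suc (trans (ℕP.+-comm i (suc k)) (sym (ℕP.+-suc k i)))) L)

-- Transposition preserves hook lengths: arm and leg are exchanged.
hook-conj : ∀ {N xs} → Partition≤ N xs → length xs ≤ N → ∀ i j →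
  hook (conj xs) (suc j , suc i) ≡ hook xs (suc i , suc j)
hook-conj {N} {xs} d le i j = begin
  hook (conj xs) (suc j , suc i)              ≡⟨ hook-arm-leg (conj-Partition≤ N d le) j i ⟩
  suc (leg xs i j ℕ.+ leg (conj xs) j i)      ≡⟨ cong (λ z → suc (leg xs i j ℕ.+ (part z (suc i) ∸ suc j))) (conj-conj d le) ⟩
  suc (leg xs i j ℕ.+ arm xs i j)             ≡⟨ cong suc (ℕP.+-comm (leg xs i j) (arm xs i j)) ⟩
  suc (arm xs i j ℕ.+ leg xs i j)             ≡⟨ sym (hook-arm-leg d i j) ⟩
  hook xs (suc i , suc j)                     ∎
  where open ≡-Reasoning

hook-bound : ∀ {m xs} → Partition≤ m xs → ∀ i j → j < part xs (suc i) → hook xs (suc i , suc j) ≤ sum xs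
hook-bound {xs = xs} d i j lt = begin
  hook xs (suc i , suc j)                          ≡⟨ hook-arm-leg d i j ⟩
  suc (arm xs i j) ℕ.+ leg xs i j                  ≡⟨ cong (ℕ._+ leg xs i j) (sym (ℕP.+-∸-assoc 1 lt)) ⟩
  (part xs (suc i) ∸ j) ℕ.+ leg xs i j             ≤⟨ ℕP.+-mono-≤ (ℕP.m∸n≤m _ j) (ℕP.∸-monoˡ-≤ (suc i) leg≤len) ⟩
  part xs (suc i) ℕ.+ (length xs ∸ suc i)          ≤⟨ row+below d i ⟩
  sum xs                                           ∎
  where
  open ℕP.≤-Reasoning
  leg≤len : part (conj xs) (suc j) ≤ length xs
  leg≤len = ℕP.≤-trans (ℕP.≤-reflexive (conj-part xs j)) (column-len (suc j) xs)
  row+below : ∀ {m xs} → Partition≤ m xs → ∀ i → part xs (suc i) ℕ.+ (length xs ∸ suc i) ≤ sum xs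
  row+below [] i = z≤n
  row+below (cons {p = p} _ _ d) zero = ℕP.+-monoʳ-≤ p (len≤sum d)
  row+below (cons {p = p} {ps} _ _ d) (suc i) = ℕP.≤-trans (row+below d i) (ℕP.m≤n+m (sum ps) p)

unique-concatMap : ∀ {B C : Set} (g : B → List C) xs → Unique xs → (∀ x → Unique (g x)) →
  (∀ {x x′ y} → y ∈ g x → y ∈ g x′ → x ≡ x′) → Unique (concatMap g xs)
unique-concatMap g [] _ _ _ = []
unique-concatMap g (x ∷ xs) (x∉xs ∷ uxs) ug disjoint =
  Unique.++⁺ (ug x) (unique-concatMap g xs uxs ug disjoint)
    (λ (y∈gx , y∈rest) → let (z , z∈xs , y∈gz) = find (∈-concatMap⁻ g y∈rest)
                         in All.lookup x∉xs z∈xs (disjoint y∈gx y∈gz))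

unique-map-on : ∀ {B C : Set} (f : B → C) xs → (∀ {x y} → x ∈ xs → y ∈ xs → f x ≡ f y → x ≡ y) →
  Unique xs → Unique (map f xs)
unique-map-on f [] inj _ = []
unique-map-on f (x ∷ xs) inj (x∉xs ∷ uxs) =
  All.tabulate (λ y∈ fx≡y → let (z , z∈xs , y≡fz) = ∈-map⁻ f y∈
                            in All.lookup x∉xs z∈xs (inj (here refl) (there z∈xs) (trans fx≡y y≡fz)))
  ∷ unique-map-on f xs (λ x∈ y∈ → inj (there x∈) (there y∈)) uxs

IsPartition : ℕ → List ℕ → Set
IsPartition ℓ xs = Partition≤ ℓ xs × sum xs ≡ ℓ

partsLe-sound : ∀ f m k xs → xs ∈ partsLe f m k → Partition≤ m xs × sum xs ≡ k
partsLe-sound f m zero xs (here refl) = [] , refl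
partsLe-sound (suc f) m (suc k) xs mem
  with find (∈-concatMap⁻ (λ i → map (suc i ∷_) (partsLe f (suc i) (suc k ∸ suc i))) {xs = upTo (m ⊓ suc k)} mem)
... | i , i∈ , ys∈ with ∈-map⁻ (suc i ∷_) ys∈
... | ys , ys∈′ , refl with partsLe-sound f (suc i) (suc k ∸ suc i) ys ys∈′
... | d , sum≡ = cons (s≤s z≤n) (ℕP.≤-trans i<min (ℕP.m⊓n≤m m (suc k))) d ,
                 trans (cong (suc i ℕ.+_) sum≡) (ℕP.m+[n∸m]≡n (ℕP.≤-trans i<min (ℕP.m⊓n≤n m (suc k))))
  where i<min = ∈-upTo⁻ i∈

partsLe-complete : ∀ f m k xs → Partition≤ m xs → sum xs ≡ k → k ≤ f → xs ∈ partsLe f m k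
partsLe-complete f m zero [] d s le = here refl
partsLe-complete f m zero (p ∷ ps) (cons 1≤p _ _) s le =
  ⊥-elim (ℕP.<⇒≢ (ℕP.≤-trans 1≤p (ℕP.m≤m+n p (sum ps))) (sym s))
partsLe-complete (suc f) m (suc k) (suc i ∷ ps) (cons _ i<m d) s (s≤s k≤f) =
  ∈-concatMap⁺ (λ i → map (suc i ∷_) (partsLe f (suc i) (suc k ∸ suc i))) {xs = upTo (m ⊓ suc k)}
    (lose (∈-upTo⁺ (ℕP.⊓-glb i<m i<sk))
          (∈-map⁺ (suc i ∷_) (partsLe-complete f (suc i) (suc k ∸ suc i) ps d sum-ps
                                (ℕP.≤-trans (ℕP.m∸n≤m k i) k≤f))))
  where
  i<sk : suc i ≤ suc k
  i<sk = subst (suc i ≤_) s (ℕP.m≤m+n (suc i) (sum ps))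
  sum-ps : sum ps ≡ suc k ∸ suc i
  sum-ps = trans (sym (ℕP.m+n∸m≡n (suc i) (sum ps))) (cong (_∸ suc i) s)

partsLe-unique : ∀ f m k → Unique (partsLe f m k)
partsLe-unique f m zero = All.[] ∷ []
partsLe-unique zero m (suc k) = []
partsLe-unique (suc f) m (suc k) =
  unique-concatMap _ (upTo (m ⊓ suc k)) (Unique.upTo⁺ _)
    (λ i → Unique.map⁺ LP.∷-injectiveʳ (partsLe-unique f (suc i) (suc k ∸ suc i)))
    (λ {i} {i′} m₁ m₂ → let (a , _ , a≡) = ∈-map⁻ (suc i ∷_) m₁
                            (b , _ , b≡) = ∈-map⁻ (suc i′ ∷_) m₂
                        in ℕP.suc-injective (LP.∷-injectiveˡ (trans (sym a≡) b≡)))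

partitions-sound : ∀ ℓ xs → xs ∈ partitions ℓ → IsPartition ℓ xs
partitions-sound ℓ xs = partsLe-sound ℓ ℓ ℓ xs

partitions-complete : ∀ ℓ xs → IsPartition ℓ xs → xs ∈ partitions ℓ
partitions-complete ℓ xs (d , s) = partsLe-complete ℓ ℓ ℓ xs d s ℕP.≤-refl

length≤ : ∀ {ℓ xs} → IsPartition ℓ xs → length xs ≤ ℓ
length≤ {xs = xs} (d , s) = subst (length xs ≤_) s (len≤sum d)

conj-IsPartition : ∀ {ℓ xs} → IsPartition ℓ xs → IsPartition ℓ (conj xs)
conj-IsPartition p@(d , s) = conj-Partition≤ _ d (length≤ p) , trans (sum-conj d (length≤ p)) s

conj-perm : ∀ ℓ → map conj (partitions ℓ) ↭ partitions ℓ
conj-perm ℓ = ∼bag⇒↭ (unique∧set⇒bag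
  (unique-map-on conj (partitions ℓ)
     (λ {x} {y} x∈ y∈ e → trans (sym (involutive x x∈)) (trans (cong conj e) (involutive y y∈)))
     (partsLe-unique ℓ ℓ ℓ))
  (partsLe-unique ℓ ℓ ℓ)
  (mk⇔ into onto))
  where
  involutive : ∀ xs → xs ∈ partitions ℓ → conj (conj xs) ≡ xs
  involutive xs xs∈ = let p@(d , _) = partitions-sound ℓ xs xs∈ in conj-conj d (length≤ p)
  conj∈ : ∀ {xs} → xs ∈ partitions ℓ → conj xs ∈ partitions ℓ
  conj∈ {xs} xs∈ = partitions-complete ℓ _ (conj-IsPartition (partitions-sound ℓ xs xs∈))
  into : ∀ {μ} → μ ∈ map conj (partitions ℓ) → μ ∈ partitions ℓ
  into μ∈ with ∈-map⁻ conj μ∈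
  ... | xs , xs∈ , refl = conj∈ xs∈
  onto : ∀ {μ} → μ ∈ partitions ℓ → μ ∈ map conj (partitions ℓ)
  onto {μ} μ∈ = subst (_∈ map conj (partitions ℓ)) (involutive μ μ∈) (∈-map⁺ conj (conj∈ μ∈))

cellFactor : ℤ → ℚ → ℚ → List ℕ → ℕ × ℕ → ℚ
cellFactor n u t xs x = (1ℚ - (u ^ᶻ (n ℤ.+ content x))) ÷' ((1ℚ - (u ^ hook xs x)) * (1ℚ - (t ^ hook xs x)))

term : ℤ → ℚ → ℚ → List ℕ → ℚ
term n u t xs = ((u * t) ^ bstat xs) * prod (map (cellFactor n u t xs) (cells xs))

open ℚDiagram using (Π; Πλ; Πλ-ext; Πλ-∙; Πλ-conj; Πλ-rev; Πλ-rows; Πλ-const; pow)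

pow≡^ : ∀ q k → pow q k ≡ q ^ k
pow≡^ q zero = refl
pow≡^ q (suc k) = cong (q *_) (pow≡^ q k)

prod-cells : ∀ {N xs} → Partition≤ N xs → length xs ≤ N → ∀ (G : ℕ × ℕ → ℚ) →
  prod (map G (cells xs)) ≡ Πλ xs N (λ i j → G (suc i , suc j))
prod-cells {N} {xs} d le G = begin
  prod (map G (cells xs))
    ≡⟨ ℚDiagram.big-concatMap G _ (upTo (length xs)) ⟩
  prod (map (λ i → prod (map G (map (λ j → (suc i , suc j)) (upTo (part xs (suc i)))))) (upTo (length xs)))
    ≡⟨ cong prod (LP.map-cong row (upTo (length xs))) ⟩
  prod (map (λ i → Π (part xs (suc i)) (λ j → G (suc i , suc j))) (upTo (length xs)))
    ≡⟨ ℚDiagram.big-upTo _ (length xs) ⟩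
  Π (length xs) (λ i → Π (part xs (suc i)) (λ j → G (suc i , suc j)))
    ≡⟨ Πλ-rows d le _ ⟩
  Πλ xs N (λ i j → G (suc i , suc j)) ∎
  where
  open ≡-Reasoning
  row : ∀ i → prod (map G (map (λ j → (suc i , suc j)) (upTo (part xs (suc i)))))
            ≡ Π (part xs (suc i)) (λ j → G (suc i , suc j))
  row i = trans (cong prod (sym (LP.map-∘ (upTo (part xs (suc i)))))) (ℚDiagram.big-upTo _ (part xs (suc i)))

^-bstat : ∀ {N xs} → Partition≤ N xs → length xs ≤ N → ∀ q → q ^ bstat xs ≡ Πλ xs N (λ i j → q ^ i)
^-bstat {N} {xs} d le q = begin
  q ^ sum (map weight (upTo (length xs)))                  ≡⟨ ^-sum (upTo (length xs)) ⟩
  prod (map (λ i → q ^ weight i) (upTo (length xs)))       ≡⟨ ℚDiagram.big-upTo _ (length xs) ⟩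
  Π (length xs) (λ i → q ^ (i ℕ.* part xs (suc i)))        ≡⟨ ℚDiagram.Π-ext (length xs) (λ i _ → row i) ⟩
  Π (length xs) (λ i → Π (part xs (suc i)) (λ j → q ^ i))  ≡⟨ Πλ-rows d le _ ⟩
  Πλ xs N (λ i j → q ^ i)                                  ∎
  where
  open ≡-Reasoning
  weight = λ i → i ℕ.* part xs (suc i)
  ^-sum : ∀ ks → q ^ sum (map weight ks) ≡ prod (map (λ i → q ^ weight i) ks)
  ^-sum [] = refl
  ^-sum (k ∷ ks) = trans (^-+ q (weight k) _) (cong (q ^ weight k *_) (^-sum ks))
  row : ∀ i → q ^ (i ℕ.* part xs (suc i)) ≡ pow (q ^ i) (part xs (suc i))
  row i = trans (^-* q i (part xs (suc i))) (sym (pow≡^ (q ^ i) (part xs (suc i))))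

term-diagram : ∀ {N xs} → Partition≤ N xs → length xs ≤ N → ∀ n u t →
  term n u t xs ≡ Πλ xs N (λ i j → (u * t) ^ i * cellFactor n u t xs (suc i , suc j))
term-diagram {N} {xs} d le n u t =
  trans (cong₂ _*_ (^-bstat d le (u * t)) (prod-cells d le _)) (sym (Πλ-∙ xs N _ _))

-- Σ_x h(x) = |λ| + b(λ') + b(λ), multiplicatively: the arms of each row
-- reproduce the column indices j, the legs of each column the row indices i.
hook-sum : ∀ {N xs} → Partition≤ N xs → length xs ≤ N → ∀ t →
  Πλ xs N (λ i j → t ^ hook xs (suc i , suc j)) ≡ Πλ xs N (λ i j → t * (t ^ j * t ^ i))
hook-sum {N} {xs} d le t = begin
  Πλ xs N (λ i j → t ^ hook xs (suc i , suc j))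
    ≡⟨ Πλ-ext xs N (λ i j _ → trans (cong (t ^_) (hook-arm-leg d i j)) (cong (t *_) (^-+ t (arm xs i j) _))) ⟩
  Πλ xs N (λ i j → t * (t ^ arm xs i j * t ^ leg xs i j))
    ≡⟨ trans (Πλ-∙ xs N _ _) (cong (Πλ xs N (λ _ _ → t) *_) (Πλ-∙ xs N _ _)) ⟩
  Πλ xs N (λ _ _ → t) * (Πλ xs N (λ i j → t ^ arm xs i j) * Πλ xs N (λ i j → t ^ leg xs i j))
    ≡⟨ cong (λ z → Πλ xs N (λ _ _ → t) * z) (cong₂ _*_ (Πλ-rev d le (t ^_)) legs) ⟩
  Πλ xs N (λ _ _ → t) * (Πλ xs N (λ i j → t ^ j) * Πλ xs N (λ i j → t ^ i))
    ≡⟨ sym (trans (Πλ-∙ xs N _ _) (cong (Πλ xs N (λ _ _ → t) *_) (Πλ-∙ xs N _ _))) ⟩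
  Πλ xs N (λ i j → t * (t ^ j * t ^ i)) ∎
  where
  open ≡-Reasoning
  legs : Πλ xs N (λ i j → t ^ leg xs i j) ≡ Πλ xs N (λ i j → t ^ i)
  legs = trans (sym (Πλ-conj d N (λ j i → t ^ leg xs i j)))
    (trans (Πλ-rev (conj-Partition≤ N d le) (conj-length d) (t ^_)) (Πλ-conj d N (λ j i → t ^ i)))

content-conj : ∀ n i j → ℤ.- n ℤ.+ content (suc j , suc i) ≡ ℤ.- (n ℤ.+ content (suc i , suc j))
content-conj n i j = solve 3 (λ n I J → :- n :+ (I :- J) := :- (n :+ (J :- I))) refl n (+ suc i) (+ suc j)
  where open ℤSolver.+-*-Solver

content-shift : ∀ n i j → (n ℤ.+ content (suc i , suc j)) ℤ.+ + i ≡ n ℤ.+ + j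
content-shift n i j =
  solve 3 (λ n I J → (n :+ ((con (+ 1) :+ J) :- (con (+ 1) :+ I))) :+ I := n :+ J) refl n (+ i) (+ j)
  where open ℤSolver.+-*-Solver

invert-factor : ∀ U W T S → U ≢ 0ℚ → T * S ≡ 1ℚ → 1ℚ - W ≢ 0ℚ → 1ℚ - T ≢ 0ℚ → 1ℚ - S ≢ 0ℚ →
  (1ℚ - U) ÷' ((1ℚ - W) * (1ℚ - S)) ≡ (U * ((1ℚ - inv U) ÷' ((1ℚ - W) * (1ℚ - T)))) * T
invert-factor U W T S U≢0 TS≡1 W≢1 T≢1 S≢1 = trans
  (cross-multiply (1ℚ - U) ((1ℚ - W) * (1ℚ - S)) (U * (1ℚ - V) * T) ((1ℚ - W) * (1ℚ - T))
     (*-nonzero _ _ W≢1 S≢1) (*-nonzero _ _ W≢1 T≢1) cross)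
  (solve 5 (λ U V T W e → U :* (con 1ℚ :- V) :* T :* e := (U :* ((con 1ℚ :- V) :* e)) :* T)
     refl U V T W (inv ((1ℚ - W) * (1ℚ - T))))
  where
  open ≡-Reasoning
  open +-*-Solver
  V = inv U
  cross : (1ℚ - U) * ((1ℚ - W) * (1ℚ - T)) ≡ U * (1ℚ - V) * T * ((1ℚ - W) * (1ℚ - S))
  cross = sym (begin
    U * (1ℚ - V) * T * ((1ℚ - W) * (1ℚ - S))
      ≡⟨ solve 5 (λ U V T S W → U :* (con 1ℚ :- V) :* T :* ((con 1ℚ :- W) :* (con 1ℚ :- S))
            := (con 1ℚ :- W) :* (U :* T :- (U :* V) :* T :- U :* (T :* S) :+ (U :* V) :* (T :* S)))
            refl U V T S W ⟩
    (1ℚ - W) * (U * T - (U * V) * T - U * (T * S) + (U * V) * (T * S))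
      ≡⟨ cong₂ (λ a b → (1ℚ - W) * (U * T - a * T - U * b + a * b)) (inv-r U U≢0) TS≡1 ⟩
    (1ℚ - W) * (U * T - 1ℚ * T - U * 1ℚ + 1ℚ * 1ℚ)
      ≡⟨ solve 3 (λ U T W → (con 1ℚ :- W) :* (U :* T :- con 1ℚ :* T :- U :* con 1ℚ :+ con 1ℚ :* con 1ℚ)
            := (con 1ℚ :- U) :* ((con 1ℚ :- W) :* (con 1ℚ :- T))) refl U T W ⟩
    (1ℚ - U) * ((1ℚ - W) * (1ℚ - T)) ∎)

module Reciprocity (n : ℤ) (ℓ : ℕ) (u t : ℚ) (u≢0 : u ≢ 0ℚ) (t≢0 : t ≢ 0ℚ)
  (u^k≢1 : ∀ k → 1 ≤ k → k ≤ ℓ → u ^ k ≢ 1ℚ) (t^k≢1 : ∀ k → 1 ≤ k → k ≤ ℓ → t ^ k ≢ 1ℚ) where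

  s N : ℚ
  s = inv t
  N = u ^ᶻ n

  ts≡1 : t * s ≡ 1ℚ
  ts≡1 = inv-r t t≢0

  -- The factor that the cell (i,j) of λ has as the cell (j,i) of λ' in X_{−n}(u,t).
  mirrorFactor : List ℕ → ℕ → ℕ → ℚ
  mirrorFactor xs i j = (1ℚ - u ^ᶻ (ℤ.- (n ℤ.+ content (suc i , suc j)))) ÷' ((1ℚ - u ^ h) * (1ℚ - t ^ h))
    where h = hook xs (suc i , suc j)

  flip-factor : ∀ z h → 1 ≤ h → h ≤ ℓ →
    (1ℚ - u ^ᶻ z) ÷' ((1ℚ - u ^ h) * (1ℚ - s ^ h))
      ≡ (u ^ᶻ z * ((1ℚ - u ^ᶻ (ℤ.- z)) ÷' ((1ℚ - u ^ h) * (1ℚ - t ^ h)))) * t ^ h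
  flip-factor z h 1≤h h≤ℓ = trans
    (invert-factor (u ^ᶻ z) (u ^ h) (t ^ h) (s ^ h) (^ᶻ-nonzero u z u≢0) (^-inverse t s h ts≡1)
       (1-x≢0 _ (u^k≢1 h 1≤h h≤ℓ)) (1-x≢0 _ (t^k≢1 h 1≤h h≤ℓ)) (1-x≢0 _ s^h≢1))
    (cong (λ v → (u ^ᶻ z * ((1ℚ - v) ÷' ((1ℚ - u ^ h) * (1ℚ - t ^ h)))) * t ^ h) (sym (^ᶻ-neg u z u≢0)))
    where
    s^h≢1 : s ^ h ≢ 1ℚ
    s^h≢1 e = t^k≢1 h 1≤h h≤ℓ
      (trans (sym (*-identityʳ _)) (trans (cong (t ^ h *_) (sym e)) (^-inverse t s h ts≡1)))

  shift-weight : ∀ i j R → let U = u ^ᶻ (n ℤ.+ content (suc i , suc j)) in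
    ((u * s) ^ i * (U * R)) * (t * (t ^ j * t ^ i)) ≡ (t * N) * ((u * t) ^ j * R)
  shift-weight i j R = begin
    ((u * s) ^ i * (U * R)) * (t * (t ^ j * t ^ i))
      ≡⟨ cong (λ a → (a * (U * R)) * (t * (t ^ j * t ^ i))) (*-^ u s i) ⟩
    ((u ^ i * s ^ i) * (U * R)) * (t * (t ^ j * t ^ i))
      ≡⟨ solve 7 (λ ui si U R t tj ti → ((ui :* si) :* (U :* R)) :* (t :* (tj :* ti))
                   := ((U :* ui) :* (si :* ti)) :* (t :* (tj :* R)))
           refl (u ^ i) (s ^ i) U R t (t ^ j) (t ^ i) ⟩
    ((U * u ^ i) * (s ^ i * t ^ i)) * (t * (t ^ j * R))
      ≡⟨ cong₂ (λ a b → (a * b) * (t * (t ^ j * R))) content-weight (^-inverse s t i (trans (*-comm s t) ts≡1)) ⟩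
    ((N * u ^ j) * 1ℚ) * (t * (t ^ j * R))
      ≡⟨ solve 5 (λ N uj t tj R → ((N :* uj) :* con 1ℚ) :* (t :* (tj :* R)) := (t :* N) :* ((uj :* tj) :* R))
           refl N (u ^ j) t (t ^ j) R ⟩
    (t * N) * ((u ^ j * t ^ j) * R)
      ≡⟨ cong (λ z → (t * N) * (z * R)) (sym (*-^ u t j)) ⟩
    (t * N) * ((u * t) ^ j * R) ∎
    where
    open ≡-Reasoning
    open +-*-Solver
    c = n ℤ.+ content (suc i , suc j)
    U = u ^ᶻ c
    content-weight : U * u ^ i ≡ N * u ^ j
    content-weight = trans (sym (^ᶻ-+ u c i u≢0)) (trans (cong (u ^ᶻ_) (content-shift n i j)) (^ᶻ-+ u n j u≢0))

  conjugate-side : ∀ {xs} → Partition≤ ℓ xs → length xs ≤ ℓ →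
    term (ℤ.- n) u t (conj xs) ≡ Πλ xs ℓ (λ i j → (u * t) ^ j * mirrorFactor xs i j)
  conjugate-side {xs} d le = begin
    term (ℤ.- n) u t (conj xs)
      ≡⟨ term-diagram (conj-Partition≤ ℓ d le) (conj-length d) (ℤ.- n) u t ⟩
    Πλ (conj xs) ℓ (λ j i → (u * t) ^ j * cellFactor (ℤ.- n) u t (conj xs) (suc j , suc i))
      ≡⟨ Πλ-conj d ℓ _ ⟩
    Πλ xs ℓ (λ i j → (u * t) ^ j * cellFactor (ℤ.- n) u t (conj xs) (suc j , suc i))
      ≡⟨ Πλ-ext xs ℓ (λ i j _ → cong ((u * t) ^ j *_) (transposed-cell i j)) ⟩
    Πλ xs ℓ (λ i j → (u * t) ^ j * mirrorFactor xs i j) ∎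
    where
    open ≡-Reasoning
    transposed-cell : ∀ i j → cellFactor (ℤ.- n) u t (conj xs) (suc j , suc i) ≡ mirrorFactor xs i j
    transposed-cell i j = cong₂ (λ z h → (1ℚ - u ^ᶻ z) ÷' ((1ℚ - u ^ h) * (1ℚ - t ^ h)))
                                (content-conj n i j) (hook-conj d le i j)

  term-reciprocity : ∀ xs → IsPartition ℓ xs → term n u s xs ≡ (t * N) ^ ℓ * term (ℤ.- n) u t (conj xs)
  term-reciprocity xs p@(d , size) = begin
    term n u s xs                                       ≡⟨ term-diagram d le n u s ⟩
    Πλ xs ℓ (λ i j → (u * s) ^ i * F i j)               ≡⟨ Πλ-ext xs ℓ flip-cell ⟩
    Πλ xs ℓ (λ i j → A i j * t ^ h i j)                 ≡⟨ Πλ-∙ xs ℓ _ _ ⟩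
    Πλ xs ℓ A * Πλ xs ℓ (λ i j → t ^ h i j)             ≡⟨ cong (Πλ xs ℓ A *_) (hook-sum d le t) ⟩
    Πλ xs ℓ A * Πλ xs ℓ (λ i j → t * (t ^ j * t ^ i))   ≡⟨ sym (Πλ-∙ xs ℓ _ _) ⟩
    Πλ xs ℓ (λ i j → A i j * (t * (t ^ j * t ^ i)))     ≡⟨ Πλ-ext xs ℓ (λ i j _ → shift-weight i j (R i j)) ⟩
    Πλ xs ℓ (λ i j → (t * N) * ((u * t) ^ j * R i j))   ≡⟨ Πλ-∙ xs ℓ _ _ ⟩
    Πλ xs ℓ (λ _ _ → t * N) * Πλ xs ℓ (λ i j → (u * t) ^ j * R i j)
      ≡⟨ cong₂ _*_ constant (sym (conjugate-side d le)) ⟩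
    (t * N) ^ ℓ * term (ℤ.- n) u t (conj xs)            ∎
    where
    open ≡-Reasoning
    le = length≤ p
    h : ℕ → ℕ → ℕ
    h i j = hook xs (suc i , suc j)
    F R A : ℕ → ℕ → ℚ
    F i j = cellFactor n u s xs (suc i , suc j)
    R = mirrorFactor xs
    A i j = (u * s) ^ i * (u ^ᶻ (n ℤ.+ content (suc i , suc j)) * R i j)
    flip-cell : ∀ i j → j < part xs (suc i) → (u * s) ^ i * F i j ≡ A i j * t ^ h i j
    flip-cell i j j<λᵢ = trans
      (cong ((u * s) ^ i *_) (flip-factor (n ℤ.+ content (suc i , suc j)) (h i j) (s≤s z≤n)
                               (subst (h i j ≤_) size (hook-bound d i j j<λᵢ))))
      (sym (*-assoc ((u * s) ^ i) _ (t ^ h i j)))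
    constant : Πλ xs ℓ (λ _ _ → t * N) ≡ (t * N) ^ ℓ
    constant = trans (Πλ-const d le (t * N)) (trans (cong (pow (t * N)) size) (pow≡^ _ ℓ))

  sum-reciprocity : sumℚ (map (term n u s) (partitions ℓ))
                  ≡ (t * N) ^ ℓ * sumℚ (map (term (ℤ.- n) u t) (partitions ℓ))
  sum-reciprocity = begin
    sumℚ (map (term n u s) P)                           ≡⟨ cong sumℚ (LP.map-cong-local (All.tabulate summand)) ⟩
    sumℚ (map (λ xs → c * term n′ u t (conj xs)) P)     ≡⟨ scale P ⟩
    c * sumℚ (map (term n′ u t ∘ conj) P)               ≡⟨ cong (λ z → c * sumℚ z) (LP.map-∘ P) ⟩
    c * sumℚ (map (term n′ u t) (map conj P))           ≡⟨ cong (c *_) (sum-↭ (Perm.map⁺ (term n′ u t) (conj-perm ℓ))) ⟩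
    c * sumℚ (map (term n′ u t) P)                      ∎
    where
    open ≡-Reasoning
    P = partitions ℓ
    n′ = ℤ.- n
    c = (t * N) ^ ℓ
    summand : ∀ {xs} → xs ∈ P → term n u s xs ≡ c * term n′ u t (conj xs)
    summand {xs} xs∈ = term-reciprocity xs (partitions-sound ℓ xs xs∈)
    scale : ∀ (ys : List (List ℕ)) → sumℚ (map (λ xs → c * term n′ u t (conj xs)) ys) ≡ c * sumℚ (map (term n′ u t ∘ conj) ys)
    scale [] = sym (ℚP.*-zeroʳ c)
    scale (y ∷ ys) = trans (cong (λ z → c * term n′ u t (conj y) + z) (scale ys)) (sym (ℚP.*-distribˡ-+ c _ _))
    sum-↭ : ∀ {xs ys} → xs ↭ ys → sumℚ xs ≡ sumℚ ys
    sum-↭ p = PermSetoid.foldr-commMonoid (setoid ℚ) ℚP.+-0-isCommutativeMonoid (↭⇒↭ₛ p)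

-- The prefactors: if t s = 1 then  t^(k choose 2) t^k (s;s)_k = (−1)^k (t;t)_k,
-- since each factor satisfies t^{i+1} (1 − s^{i+1}) = −(1 − t^{i+1}).
poch-reciprocity : ∀ t s → t * s ≡ 1ℚ → ∀ k → (t ^ binom2 k * t ^ k) * poch s s k ≡ (- 1ℚ) ^ k * poch t t k
poch-reciprocity t s ts≡1 k =
  trans (cong ((t ^ binom2 k * t ^ k) *_) (ℚDiagram.big-upTo _ k))
        (trans (by-factors k) (cong ((- 1ℚ) ^ k *_) (sym (ℚDiagram.big-upTo _ k))))
  where
  open ≡-Reasoning
  open +-*-Solver
  f g : ℕ → ℚ
  f i = 1ℚ - s * s ^ i
  g i = 1ℚ - t * t ^ i
  last-factor : ∀ k → t ^ suc k * f k ≡ (- 1ℚ) * g k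
  last-factor k = begin
    t ^ suc k * (1ℚ - s ^ suc k)          ≡⟨ solve 2 (λ T S → T :* (con 1ℚ :- S) := T :- T :* S) refl (t ^ suc k) (s ^ suc k) ⟩
    t ^ suc k - t ^ suc k * s ^ suc k     ≡⟨ cong (λ z → t ^ suc k - z) (^-inverse t s (suc k) ts≡1) ⟩
    t ^ suc k - 1ℚ                        ≡⟨ solve 1 (λ T → T :- con 1ℚ := (:- con 1ℚ) :* (con 1ℚ :- T)) refl (t ^ suc k) ⟩
    (- 1ℚ) * (1ℚ - t ^ suc k)             ∎
  by-factors : ∀ k → (t ^ binom2 k * t ^ k) * Π k f ≡ (- 1ℚ) ^ k * Π k g
  by-factors zero = refl
  by-factors (suc k) = begin
    (t ^ (k ℕ.+ binom2 k) * t ^ suc k) * Π (suc k) f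
      ≡⟨ cong₂ (λ a b → (a * t ^ suc k) * b) (^-+ t k (binom2 k)) (ℚDiagram.Π-snoc k f) ⟩
    ((t ^ k * t ^ binom2 k) * t ^ suc k) * (Π k f * f k)
      ≡⟨ solve 5 (λ a b c P F → ((a :* b) :* c) :* (P :* F) := ((b :* a) :* P) :* (c :* F))
           refl (t ^ k) (t ^ binom2 k) (t ^ suc k) (Π k f) (f k) ⟩
    ((t ^ binom2 k * t ^ k) * Π k f) * (t ^ suc k * f k)
      ≡⟨ cong₂ _*_ (by-factors k) (last-factor k) ⟩
    ((- 1ℚ) ^ k * Π k g) * ((- 1ℚ) * g k)
      ≡⟨ solve 4 (λ m P G o → (m :* P) :* (o :* G) := (o :* m) :* (P :* G)) refl ((- 1ℚ) ^ k) (Π k g) (g k) (- 1ℚ) ⟩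
    (- 1ℚ) ^ suc k * (Π k g * g k)
      ≡⟨ cong ((- 1ℚ) ^ suc k *_) (sym (ℚDiagram.Π-snoc k g)) ⟩
    (- 1ℚ) ^ suc k * Π (suc k) g ∎

proposition4p1 : (n : ℤ) (ℓ : ℕ) → 1 ≤ ℓ → (u t : ℚ) → u ≢ 0ℚ → t ≢ 0ℚ
    → (∀ k → 1 ≤ k → k ≤ ℓ → u ^ k ≢ 1ℚ) → (∀ k → 1 ≤ k → k ≤ ℓ → t ^ k ≢ 1ℚ)
    → (t ^ binom2 ℓ) * X n ℓ u (inv t) ≡ ((- (u ^ᶻ n)) ^ ℓ) * X (Data.Integer.-_ n) ℓ u t
proposition4p1 n ℓ _ u t u≢0 t≢0 u^k≢1 t^k≢1 = begin
  t ^ binom2 ℓ * (poch s s ℓ * sumℚ (map (term n u s) P))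
    ≡⟨ cong (λ z → t ^ binom2 ℓ * (poch s s ℓ * z)) sum-reciprocity ⟩
  t ^ binom2 ℓ * (poch s s ℓ * ((t * N) ^ ℓ * Σ))
    ≡⟨ cong (λ z → t ^ binom2 ℓ * (poch s s ℓ * (z * Σ))) (*-^ t N ℓ) ⟩
  t ^ binom2 ℓ * (poch s s ℓ * ((t ^ ℓ * N ^ ℓ) * Σ))
    ≡⟨ solve 5 (λ a p b m S → a :* (p :* ((b :* m) :* S)) := ((a :* b) :* p) :* (m :* S))
         refl (t ^ binom2 ℓ) (poch s s ℓ) (t ^ ℓ) (N ^ ℓ) Σ ⟩
  ((t ^ binom2 ℓ * t ^ ℓ) * poch s s ℓ) * (N ^ ℓ * Σ)
    ≡⟨ cong (_* (N ^ ℓ * Σ)) (poch-reciprocity t s ts≡1 ℓ) ⟩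
  ((- 1ℚ) ^ ℓ * poch t t ℓ) * (N ^ ℓ * Σ)
    ≡⟨ solve 4 (λ o p m S → (o :* p) :* (m :* S) := (o :* m) :* (p :* S)) refl ((- 1ℚ) ^ ℓ) (poch t t ℓ) (N ^ ℓ) Σ ⟩
  ((- 1ℚ) ^ ℓ * N ^ ℓ) * (poch t t ℓ * Σ)
    ≡⟨ cong (_* (poch t t ℓ * Σ)) (trans (sym (*-^ (- 1ℚ) N ℓ)) (cong (_^ ℓ) (solve 1 (λ N → (:- con 1ℚ) :* N := :- N) refl N))) ⟩
  (- N) ^ ℓ * (poch t t ℓ * Σ) ∎
  where
  open ≡-Reasoning
  open +-*-Solver
  open Reciprocity n ℓ u t u≢0 t≢0 u^k≢1 t^k≢1 using (s; N; ts≡1; sum-reciprocity)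
  P = partitions ℓ
  Σ = sumℚ (map (term (ℤ.- n) u t) P)
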